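{- Let $k\ge 1$ and let $G$ be a maximal $k$-degenerate graph with at least $k+2$ vertices. Then $G$ contains no two adjacent vertices that both have degree exactly $k$.
   Context: Graphs are finite, simple and undirected. For an ordering (bijection) $\phi:V\to[|V|]$ and $v\in V$, let $d_p(v)$ be the number of neighbours $u$ of $v$ with $\phi(u)<\phi(v)$. $G$ is maximal $k$-degenerate if it has an ordering $\phi$ with $d_p(v)=\min(k,\phi(v)-1)$ for every vertex $v$. -}

module Defs where

open import Data.Nat using (ℕ; _⊓_; _<_)
open import Data.Fin using (Fin; toℕ)
open import Data.Fin.Permutation using (Permutation′; _⟨$⟩ʳ_)
open import Data.List using (List; length; filter)
open import Data.Fin.Properties using (_<?_)
open import Data.List using (allFin)
open import Relation.Nullary using (Dec; ¬_)
open import Relation.Nullary.Decidable using (_×-dec_)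
open import Relation.Binary.PropositionalEquality using (_≡_)
open import Data.Product using (_×_)

record Graph (n : ℕ) : Set₁ where
  field
    Adj      : Fin n → Fin n → Set
    adj?     : (u v : Fin n) → Dec (Adj u v)
    sym      : ∀ {u v} → Adj u v → Adj v u
    irrefl   : ∀ {v} → ¬ Adj v v

open Graph public

neighbours : ∀ {n} → Graph n → Fin n → List (Fin n)
neighbours G v = filter (λ u → adj? G u v) (allFin _)

degree : ∀ {n} → Graph n → Fin n → ℕ
degree G v = length (neighbours G v)

-- An ordering φ : V → [|V|] is a bijection; we use 0-based positions Fin n,
-- so φ(v) - 1 in the paper corresponds to toℕ (φ v) here.
Ordering : ℕ → Set
Ordering n = Permutation′ n

dp : ∀ {n} → Graph n → Ordering n → Fin n → ℕ
dp G φ v = length (filter (λ u → adj? G u v ×-dec ((φ ⟨$⟩ʳ u) <? (φ ⟨$⟩ʳ v))) (allFin _))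

MaximalDegenerate : ∀ {n} → ℕ → Graph n → Set
MaximalDegenerate {n} k G =
  Data.Product.Σ (Ordering n) λ φ → ∀ v → dp G φ v ≡ k ⊓ toℕ (φ ⟨$⟩ʳ v)

-- A vertex at position p ≤ k has p earlier neighbours among
-- its p predecessors, so the first k + 1 vertices form a clique, and a degree-k vertex of this
-- clique has no neighbour outside it. If u and v are adjacent of degree k with u earlier, then v
-- is a later neighbour of u, so u has fewer than k earlier neighbours: u sits at a position below
-- k, hence v lies in the clique too. The vertex at position k + 1 (which exists since n ≥ k + 2)
-- has k earlier neighbours, all in the clique but different from u and v, of which there are
-- only k - 1.
module Submission where

open import Defs hiding (sym)
open import Data.Nat.Base using (ℕ; zero; suc; _+_; _≤_; _<_; _⊓_; z≤n; s≤s; s≤s⁻¹)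
open import Data.Nat.Properties hiding (_≟_)
open import Data.Fin.Base using (Fin; toℕ; fromℕ<) renaming (zero to fzero; suc to fsuc)
open import Data.Fin.Properties using (toℕ-injective; toℕ-fromℕ<; toℕ<n; _≟_)
  renaming (suc-injective to fsuc-injective)
open import Data.Fin.Permutation using (Permutation′; _⟨$⟩ʳ_; _⟨$⟩ˡ_; inverseʳ; inverseˡ)
open import Data.List.Base using (length; filter; tabulate)
open import Data.Product using (Σ; _×_; _,_; proj₁; proj₂)
open import Data.Empty using (⊥)
open import Function.Base using (_∘_; id)
open import Relation.Nullary using (¬_; Dec; yes; no; contradiction)
open import Relation.Unary using (Pred; Decidable; _⊆_; _≐_)
open import Relation.Unary.Properties using (_∩?_; ∁?)
open import Relation.Binary.Definitions using (tri<; tri≈; tri>)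
open import Relation.Binary.PropositionalEquality
  using (_≡_; _≢_; refl; sym; trans; cong; cong₂; subst; module ≡-Reasoning)
open import Algebra.Properties.CommutativeMonoid.Sum +-0-commutativeMonoid using (sum; sum-permute)

𝟙 : ∀ {p} {P : Set p} → Dec P → ℕ
𝟙 (yes _) = 1
𝟙 (no _)  = 0

count : ∀ {n p} {P : Pred (Fin n) p} → Decidable P → ℕ
count P? = sum (λ i → 𝟙 (P? i))

𝟙-mono : ∀ {p q} {P : Set p} {Q : Set q} → (P → Q) → (P? : Dec P) (Q? : Dec Q) → 𝟙 P? ≤ 𝟙 Q?
𝟙-mono P⇒Q (yes _) (yes _) = ≤-refl
𝟙-mono P⇒Q (yes p) (no ¬q) = contradiction (P⇒Q p) ¬q
𝟙-mono P⇒Q (no _)  _       = z≤n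

𝟙-cong : ∀ {p q} {P : Set p} {Q : Set q} → (P → Q) → (Q → P) →
         (P? : Dec P) (Q? : Dec Q) → 𝟙 P? ≡ 𝟙 Q?
𝟙-cong P⇒Q Q⇒P P? Q? = ≤-antisym (𝟙-mono P⇒Q P? Q?) (𝟙-mono Q⇒P Q? P?)

𝟙-mono-< : ∀ {p q} {P : Set p} {Q : Set q} → ¬ P → Q → (P? : Dec P) (Q? : Dec Q) → 𝟙 P? < 𝟙 Q?
𝟙-mono-< ¬p q (yes p) _      = contradiction p ¬p
𝟙-mono-< ¬p q (no _)  (yes _) = s≤s z≤n
𝟙-mono-< ¬p q (no _)  (no ¬q) = contradiction q ¬q

count-mono : ∀ {p q n} {P : Pred (Fin n) p} {Q : Pred (Fin n) q} → P ⊆ Q →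
             (P? : Decidable P) (Q? : Decidable Q) → count P? ≤ count Q?
count-mono {n = zero}  P⊆Q P? Q? = z≤n
count-mono {n = suc n} P⊆Q P? Q? =
  +-mono-≤ (𝟙-mono P⊆Q (P? fzero) (Q? fzero)) (count-mono P⊆Q (P? ∘ fsuc) (Q? ∘ fsuc))

count-mono-< : ∀ {p q n} {P : Pred (Fin n) p} {Q : Pred (Fin n) q} → P ⊆ Q →
               ∀ {j} → ¬ P j → Q j → (P? : Decidable P) (Q? : Decidable Q) → count P? < count Q?
count-mono-< P⊆Q {fzero} ¬pj qj P? Q? =
  +-mono-<-≤ (𝟙-mono-< ¬pj qj (P? fzero) (Q? fzero)) (count-mono P⊆Q (P? ∘ fsuc) (Q? ∘ fsuc))
count-mono-< P⊆Q {fsuc j} ¬pj qj P? Q? =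
  +-mono-≤-< (𝟙-mono P⊆Q (P? fzero) (Q? fzero)) (count-mono-< P⊆Q ¬pj qj (P? ∘ fsuc) (Q? ∘ fsuc))

count-cong : ∀ {p q n} {P : Pred (Fin n) p} {Q : Pred (Fin n) q} → P ≐ Q →
             (P? : Decidable P) (Q? : Decidable Q) → count P? ≡ count Q?
count-cong (P⊆Q , Q⊆P) P? Q? = ≤-antisym (count-mono P⊆Q P? Q?) (count-mono Q⊆P Q? P?)

count-⊆-≡⇒⊇ : ∀ {p q n} {P : Pred (Fin n) p} {Q : Pred (Fin n) q} → P ⊆ Q →
              (P? : Decidable P) (Q? : Decidable Q) → count P? ≡ count Q? → Q ⊆ P
count-⊆-≡⇒⊇ P⊆Q P? Q? eq {j} qj with P? j
... | yes pj = pj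
... | no ¬pj = contradiction eq (<⇒≢ (count-mono-< P⊆Q ¬pj qj P? Q?))

count-remove : ∀ {p n} {P : Pred (Fin n) p} (P? : Decidable P) {j} → P j →
               count P? ≡ suc (count (P? ∩? ∁? (_≟ j)))
count-remove P? {fzero} pj with P? fzero
... | yes _  = cong suc (count-cong ((λ p → p , λ ()) , proj₁) (P? ∘ fsuc) _)
... | no ¬pj = contradiction pj ¬pj
count-remove P? {fsuc j} pj = begin
  𝟙 (P? fzero) + count (P? ∘ fsuc)         ≡⟨ cong₂ _+_ head-kept (count-remove (P? ∘ fsuc) pj) ⟩
  𝟙 (R? fzero) + suc (count R′?)            ≡⟨ +-suc _ _ ⟩
  suc (𝟙 (R? fzero) + count R′?)            ≡⟨ cong (λ c → suc (𝟙 (R? fzero) + c)) tail-same ⟩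
  suc (𝟙 (R? fzero) + count (R? ∘ fsuc))    ∎
  where
  open ≡-Reasoning
  R? = P? ∩? ∁? (_≟ fsuc j)
  R′? = (P? ∘ fsuc) ∩? ∁? (_≟ j)
  head-kept : 𝟙 (P? fzero) ≡ 𝟙 (R? fzero)
  head-kept = 𝟙-cong (λ p → p , λ ()) proj₁ (P? fzero) (R? fzero)
  tail-same : count R′? ≡ count (R? ∘ fsuc)
  tail-same = count-cong ((λ (p , i≢j) → p , i≢j ∘ fsuc-injective) ,
                          (λ (p , si≢sj) → p , si≢sj ∘ cong fsuc))
                         R′? (R? ∘ fsuc)

count-permute : ∀ {p n} {P : Pred (Fin n) p} (π : Permutation′ n) (P? : Decidable P) →
                count (P? ∘ (π ⟨$⟩ʳ_)) ≡ count P?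
count-permute π P? = sym (sum-permute (λ i → 𝟙 (P? i)) π)

count-toℕ-< : ∀ {n m} → m ≤ n → count (λ (i : Fin n) → toℕ i <? m) ≡ m
count-toℕ-< {zero}          z≤n       = refl
count-toℕ-< {suc n} {zero}  z≤n       =
  trans (count-cong ((λ ()) , (λ ())) (λ (i : Fin n) → toℕ (fsuc i) <? 0) (λ i → toℕ i <? 0))
        (count-toℕ-< {n} z≤n)
count-toℕ-< {suc n} {suc m} (s≤s m≤n) = cong suc
  (trans (count-cong (s≤s⁻¹ , s≤s) (λ (i : Fin n) → toℕ (fsuc i) <? suc m) (λ i → toℕ i <? m))
         (count-toℕ-< {n} m≤n))

length-filter-tabulate : ∀ {a p n} {A : Set a} {P : Pred A p} (P? : Decidable P) (f : Fin n → A) →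
                         length (filter P? (tabulate f)) ≡ count (P? ∘ f)
length-filter-tabulate {n = zero}  P? f = refl
length-filter-tabulate {n = suc n} P? f with P? (f fzero)
... | yes _ = cong suc (length-filter-tabulate P? (f ∘ fsuc))
... | no _  = length-filter-tabulate P? (f ∘ fsuc)

position : ∀ {n} → Ordering n → Fin n → ℕ
position φ v = toℕ (φ ⟨$⟩ʳ v)

position-injective : ∀ {n} (φ : Ordering n) {u v} → position φ u ≡ position φ v → u ≡ v
position-injective φ {u} {v} eq = begin
  u                      ≡⟨ sym (inverseˡ φ) ⟩
  φ ⟨$⟩ˡ (φ ⟨$⟩ʳ u)      ≡⟨ cong (φ ⟨$⟩ˡ_) (toℕ-injective eq) ⟩
  φ ⟨$⟩ˡ (φ ⟨$⟩ʳ v)      ≡⟨ inverseˡ φ ⟩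
  v                      ∎
  where open ≡-Reasoning

count-position-< : ∀ {n m} (φ : Ordering n) → m ≤ n → count (λ v → position φ v <? m) ≡ m
count-position-< {m = m} φ m≤n = trans (count-permute φ (λ i → toℕ i <? m)) (count-toℕ-< m≤n)

module MaximalDegenerateOrdering {n k} (G : Graph n) (φ : Ordering n)
                                 (dp≡ : ∀ v → dp G φ v ≡ k ⊓ position φ v) where

  pos : Fin n → ℕ
  pos = position φ

  neighbour? : (v : Fin n) → Decidable (λ u → Adj G u v)
  neighbour? v u = adj? G u v

  earlier? : (v : Fin n) → Decidable (λ u → pos u < pos v)
  earlier? v u = pos u <? pos v

  initial? : Decidable (λ u → pos u < suc k)
  initial? u = pos u <? suc k

  degree≡count : ∀ v → degree G v ≡ count (neighbour? v)
  degree≡count v = length-filter-tabulate (neighbour? v) id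

  dp≡count : ∀ v → dp G φ v ≡ count (neighbour? v ∩? earlier? v)
  dp≡count v = length-filter-tabulate (neighbour? v ∩? earlier? v) id

  initial-clique : ∀ {u v} → pos v ≤ k → pos u < pos v → Adj G u v
  initial-clique {u} {v} pv≤k pu<pv =
    proj₁ (count-⊆-≡⇒⊇ proj₂ (neighbour? v ∩? earlier? v) (earlier? v) all-earlier-adjacent pu<pv)
    where
    all-earlier-adjacent : count (neighbour? v ∩? earlier? v) ≡ count (earlier? v)
    all-earlier-adjacent = begin
      count (neighbour? v ∩? earlier? v) ≡⟨ sym (dp≡count v) ⟩
      dp G φ v                           ≡⟨ dp≡ v ⟩
      k ⊓ pos v                          ≡⟨ m≥n⇒m⊓n≡n pv≤k ⟩
      pos v                              ≡⟨ sym (count-position-< φ (<⇒≤ (toℕ<n (φ ⟨$⟩ʳ v)))) ⟩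
      count (earlier? v)                 ∎
      where open ≡-Reasoning

  initial-clique-≢ : ∀ {u v} → pos u ≤ k → pos v ≤ k → u ≢ v → Adj G u v
  initial-clique-≢ {u} {v} pu≤k pv≤k u≢v with <-cmp (pos u) (pos v)
  ... | tri< pu<pv _ _ = initial-clique pv≤k pu<pv
  ... | tri≈ _ pu≡pv _ = contradiction (position-injective φ pu≡pv) u≢v
  ... | tri> _ _ pv<pu = Graph.sym G (initial-clique pu≤k pv<pu)

  dp<degree : ∀ {u v} → Adj G u v → pos v < pos u → dp G φ v < degree G v
  dp<degree {u} {v} uv pv<pu = begin-strict
    dp G φ v                           ≡⟨ dp≡count v ⟩
    count (neighbour? v ∩? earlier? v) <⟨ count-mono-< proj₁ (λ (_ , pu<pv) → <-asym pu<pv pv<pu) uv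
                                                        (neighbour? v ∩? earlier? v) (neighbour? v) ⟩
    count (neighbour? v)               ≡⟨ sym (degree≡count v) ⟩
    degree G v                         ∎
    where open ≤-Reasoning

  neighbours-within-initial : ∀ {u v} → degree G v ≡ k → pos v ≤ k → Adj G u v → pos u ≤ k
  neighbours-within-initial {u} {v} dv≡k pv≤k uv = ≮⇒≥ λ k<pu → <-irrefl refl (begin-strict
    suc k                          ≡⟨ sym (count-position-< φ (≤-trans k<pu (<⇒≤ (toℕ<n _)))) ⟩
    count initial?                 ≡⟨ count-remove initial? (s≤s pv≤k) ⟩
    suc (count initial-except-v?)  <⟨ s≤s (count-mono-< others-adjacent
                                             (λ (pu<sk , _) → <⇒≱ k<pu (s≤s⁻¹ pu<sk))
                                             uv initial-except-v? (neighbour? v)) ⟩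
    suc (count (neighbour? v))     ≡⟨ cong suc (trans (sym (degree≡count v)) dv≡k) ⟩
    suc k                          ∎)
    where
    open ≤-Reasoning
    initial-except-v? = initial? ∩? ∁? (_≟ v)
    others-adjacent : ∀ {y} → pos y < suc k × y ≢ v → Adj G y v
    others-adjacent (py<sk , y≢v) = initial-clique-≢ (s≤s⁻¹ py<sk) pv≤k y≢v

  no-later-degree-k-neighbour : suc k < n → ∀ {u v} → Adj G u v → degree G u ≡ k → degree G v ≡ k →
                                ¬ pos u < pos v
  no-later-degree-k-neighbour sk<n {u} {v} uv du≡k dv≡k pu<pv = <-irrefl refl (begin-strict
    k                                   ≡⟨ sym dp-w≡k ⟩
    dp G φ w                            ≡⟨ dp≡count w ⟩
    count (neighbour? w ∩? earlier? w)  <⟨ count-mono-< earlier-neighbours-of-w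
                                             v-not-earlier-neighbour (pv<sk , v≢u)
                                             (neighbour? w ∩? earlier? w) initial-except-u? ⟩
    count initial-except-u?             ≡⟨ suc-injective (trans (sym (count-remove initial? pu<sk))
                                                                (count-position-< φ (<⇒≤ sk<n))) ⟩
    k                                   ∎)
    where
    open ≤-Reasoning
    initial-except-u? = initial? ∩? ∁? (_≟ u)

    pu<k : pos u < k
    pu<k = ≰⇒> λ k≤pu → <-irrefl (m≤n⇒m⊓n≡m k≤pu) (begin-strict
      k ⊓ pos u  ≡⟨ sym (dp≡ u) ⟩
      dp G φ u   <⟨ dp<degree (Graph.sym G uv) pu<pv ⟩
      degree G u ≡⟨ du≡k ⟩
      k          ∎)
    pu<sk : pos u < suc k
    pu<sk = m<n⇒m<1+n pu<k
    pv≤k : pos v ≤ k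
    pv≤k = neighbours-within-initial du≡k (<⇒≤ pu<k) (Graph.sym G uv)
    pv<sk : pos v < suc k
    pv<sk = s≤s pv≤k
    v≢u : v ≢ u
    v≢u refl = irrefl G uv

    w : Fin n
    w = φ ⟨$⟩ˡ fromℕ< sk<n
    pw≡sk : pos w ≡ suc k
    pw≡sk = trans (cong toℕ (inverseʳ φ)) (toℕ-fromℕ< sk<n)
    dp-w≡k : dp G φ w ≡ k
    dp-w≡k = trans (dp≡ w) (trans (cong (k ⊓_) pw≡sk) (m≤n⇒m⊓n≡m (n≤1+n k)))
    w-not-adjacent : ∀ {x} → degree G x ≡ k → pos x ≤ k → ¬ Adj G x w
    w-not-adjacent dx≡k px≤k xw =
      1+n≰n (subst (_≤ k) pw≡sk (neighbours-within-initial dx≡k px≤k (Graph.sym G xw)))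
    v-not-earlier-neighbour : ¬ (Adj G v w × pos v < pos w)
    v-not-earlier-neighbour (vw , _) = w-not-adjacent dv≡k pv≤k vw
    earlier-neighbours-of-w : ∀ {y} → Adj G y w × pos y < pos w → pos y < suc k × y ≢ u
    earlier-neighbours-of-w (yw , py<pw) =
      subst (_ <_) pw≡sk py<pw , λ { refl → w-not-adjacent du≡k (<⇒≤ pu<k) yw }

  no-adjacent-degree-k-pair : suc k < n → ∀ {u v} → Adj G u v →
                              degree G u ≡ k → degree G v ≡ k → ⊥
  no-adjacent-degree-k-pair sk<n {u} {v} uv du≡k dv≡k with <-cmp (pos u) (pos v)
  ... | tri< pu<pv _ _ = no-later-degree-k-neighbour sk<n uv du≡k dv≡k pu<pv
  ... | tri≈ _ pu≡pv _ = irrefl G (subst (Adj G u) (sym (position-injective φ pu≡pv)) uv)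
  ... | tri> _ _ pv<pu = no-later-degree-k-neighbour sk<n (Graph.sym G uv) dv≡k du≡k pv<pu

lemma5p1 : (k n : ℕ) → 1 ≤ k → k + 2 ≤ n → (G : Graph n) → MaximalDegenerate k G →
    ¬ (Σ (Fin n) λ u → Σ (Fin n) λ v → Adj G u v × degree G u ≡ k × degree G v ≡ k)
lemma5p1 k n _ k+2≤n G (φ , dp≡) (u , v , uv , du≡k , dv≡k) =
  no-adjacent-degree-k-pair (subst (_≤ n) (+-comm k 2) k+2≤n) uv du≡k dv≡k
  where open MaximalDegenerateOrdering G φ dp≡
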